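{- Let $c \geq 2$ and let $s$ be a non-negative integer. Then the complete bipartite graph $K_{s,s}$ has an identity $c$-edge coloring except when $s = 1$ (for any $c$) and when $c = 2$ and $s \in \{2,3\}$.
   Context: A $c$-edge coloring assigns to each edge one of $c$ colors. A (color-preserving) automorphism of an edge-colored graph is a graph automorphism $\phi$ such that each edge $uv$ has the same color as the edge $\phi(u)\phi(v)$; for $K_{s,s}$ automorphisms may interchange the two parts. An identity $c$-edge coloring is a $c$-edge coloring whose only color-preserving automorphism is the identity. -}

module Defs where

open import Data.Nat using (ℕ)
open import Data.Fin using (Fin)
open import Data.Sum using (_⊎_; inj₁; inj₂)
open import Data.Product using (Σ; _×_)
open import Data.Empty using (⊥)
open import Data.Unit using (⊤)
open import Function.Bundles using (_↔_; Inverse)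
open import Relation.Binary.PropositionalEquality using (_≡_)

Vertex : ℕ → Set
Vertex s = Fin s ⊎ Fin s

Adj : {s : ℕ} → Vertex s → Vertex s → Set
Adj (inj₁ _) (inj₁ _) = ⊥
Adj (inj₁ _) (inj₂ _) = ⊤
Adj (inj₂ _) (inj₁ _) = ⊤
Adj (inj₂ _) (inj₂ _) = ⊥

-- A c-edge coloring of K_{s,s}: the edge {left i, right j} gets colour χ i j.
EdgeColoring : ℕ → ℕ → Set
EdgeColoring c s = Fin s → Fin s → Fin c

edgeColor : {c s : ℕ} → EdgeColoring c s → (u v : Vertex s) → Adj u v → Fin c
edgeColor χ (inj₁ i) (inj₂ j) _ = χ i j
edgeColor χ (inj₂ j) (inj₁ i) _ = χ i j

-- A graph automorphism of K_{s,s}: a bijection of the vertex set preserving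
-- adjacency in both directions (it may interchange the two parts).
record Automorphism (s : ℕ) : Set where
  field
    perm : Vertex s ↔ Vertex s
  φ : Vertex s → Vertex s
  φ = Inverse.to perm
  field
    preserves : ∀ u v → Adj u v → Adj (φ u) (φ v)
    reflects  : ∀ u v → Adj (φ u) (φ v) → Adj u v

ColorPreserving : {c s : ℕ} → EdgeColoring c s → Automorphism s → Set
ColorPreserving χ A =
  ∀ u v (e : Adj u v) → edgeColor χ u v e ≡ edgeColor χ (φ u) (φ v) (preserves u v e)
  where open Automorphism A

IsIdentityColoring : {c s : ℕ} → EdgeColoring c s → Set
IsIdentityColoring {s = s} χ =
  (A : Automorphism s) → ColorPreserving χ A → ∀ v → Automorphism.φ A v ≡ v

HasIdentityColoring : ℕ → ℕ → Set
HasIdentityColoring c s = Σ (EdgeColoring c s) IsIdentityColoring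

-- Index both sides of K_{s,s} by 0, …, s − 1 and colour the edge (i , j) by 1 if 0 < i and
-- j < i, and by 0 otherwise, except that row 0 is marked: either (0 , 0) gets a third colour
-- (c ≥ 3, s ≥ 2) or (0 , 2) gets colour 1 (s ≥ 4). The last column is then monochromatic while
-- no row is, so no colour-preserving automorphism swaps the sides. One that keeps them, acting
-- by σ on rows and τ on columns, fixes row 0 (the only row containing colour 2, resp. the only 0
-- of column 0, the one column with a single 0), and then j < i ⇔ τ j < σ i, which forces
-- σ = τ = id. For s = 1 swapping the sides preserves every colouring, and for c = 2, s ∈ {2, 3}
-- an exhaustive search finds a non-trivial colour-preserving automorphism of every colouring.

module Submission where

open import Defs
open import Data.Nat using (ℕ; zero; suc; _≥_; s≤s; z≤n)
import Data.Nat as ℕ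
import Data.Nat.Properties as ℕ
open import Data.Fin using (Fin; zero; suc; toℕ; inject₁; fromℕ; _<_; _≤_)
open import Data.Fin.Properties
  using (toℕ-inject₁; ≤fromℕ; ≤-antisym; <-irrefl; <-cmp; _<?_; _≟_; all?)
open import Data.Fin.Induction using (<-weakInduction; >-weakInduction)
open import Data.Fin.Permutation using (Permutation′; _⟨$⟩ʳ_; id; transpose; _∘ₚ_)
open import Data.Sum using (_⊎_; inj₁; inj₂; [_,_]; reduce)
open import Data.Sum.Properties using (inj₁-injective; inj₂-injective; ≡-dec)
open import Data.Sum.Function.Propositional using (_⊎-↔_)
open import Data.Sum.Algebra using (⊎-comm)
open import Data.Product using (_×_; _,_; ∃; ∃₂; proj₁; proj₂; uncurry)
open import Data.Empty using (⊥-elim)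
open import Data.Unit using (tt)
open import Data.Vec using (Vec; []; _∷_; lookup; tabulate)
open import Data.Vec.Properties using (lookup∘tabulate)
open import Data.List using (List; []; _∷_; concatMap)
open import Data.List.Relation.Unary.Any using (Any; any?; satisfied)
open import Function using (_∘_; _$_)
open import Function.Bundles using (_⇔_; mk⇔; Inverse; Equivalence)
open import Function.Construct.Composition using (_↔-∘_; _⇔-∘_)
open import Function.Construct.Symmetry using (⇔-sym)
open import Relation.Binary.Core using (_Preserves_⟶_)
open import Relation.Binary.Definitions using (tri<; tri≈; tri>)
open import Relation.Binary.PropositionalEquality
open import Relation.Nullary using (¬_; Dec; yes; no; contradiction)
open import Relation.Nullary.Decidable using (map′; _×-dec_; ¬?; toWitness)
open import Relation.Unary using (Decidable)

strictlyIncreasing⇒≗id : ∀ {n} (f : Fin n → Fin n) → f Preserves _<_ ⟶ _<_ → ∀ i → f i ≡ i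
strictlyIncreasing⇒≗id {suc n} f increasing i = ≤-antisym (atMost i) (atLeast i)
  where
  inject₁<suc : ∀ (i : Fin n) → inject₁ i < suc i
  inject₁<suc i = s≤s (ℕ.≤-reflexive (toℕ-inject₁ i))

  atLeast : ∀ i → i ≤ f i
  atLeast = <-weakInduction (λ i → i ≤ f i) z≤n λ i ih →
    ℕ.≤-<-trans (subst (ℕ._≤ toℕ (f (inject₁ i))) (toℕ-inject₁ i) ih) (increasing (inject₁<suc i))

  atMost : ∀ i → f i ≤ i
  atMost = >-weakInduction (λ i → f i ≤ i) (≤fromℕ _) λ i ih →
    subst (toℕ (f (inject₁ i)) ℕ.≤_) (sym (toℕ-inject₁ i))
      (ℕ.s≤s⁻¹ (ℕ.<-≤-trans (increasing (inject₁<suc i)) ih))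

-- Taking j = i gives σ ≤ τ, so σ is strictly increasing.
staircase-rigid : ∀ {n} (σ τ : Fin n → Fin n) → (∀ i j → j < i ⇔ τ j < σ i) →
  (∀ i → σ i ≡ i) × (∀ j → τ j ≡ j)
staircase-rigid σ τ stair = σ≗id , τ≗id
  where
  open Equivalence

  σ≤τ : ∀ i → σ i ≤ τ i
  σ≤τ i = ℕ.≮⇒≥ (<-irrefl refl ∘ from (stair i i))

  σ≗id : ∀ i → σ i ≡ i
  σ≗id = strictlyIncreasing⇒≗id σ λ {j} {i} j<i → ℕ.≤-<-trans (σ≤τ j) (to (stair i j) j<i)

  τ≗id : ∀ j → τ j ≡ j
  τ≗id j with <-cmp (τ j) j
  ... | tri< τj<j _ _ =
    ⊥-elim (<-irrefl refl (from (stair j j) (subst (τ j <_) (sym (σ≗id j)) τj<j)))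
  ... | tri≈ _ τj≡j _ = τj≡j
  ... | tri> _ _ j<τj = ⊥-elim (<-irrefl (sym (σ≗id (τ j))) (to (stair (τ j) j) j<τj))

module _ {s : ℕ} where

  ¬Adj[inj₁]⇒inj₁ : ∀ {a} (v : Vertex s) → ¬ Adj (inj₁ a) v → v ≡ inj₁ (reduce v)
  ¬Adj[inj₁]⇒inj₁ (inj₁ _) _ = refl
  ¬Adj[inj₁]⇒inj₁ (inj₂ _) ¬adj = ⊥-elim (¬adj tt)

  Adj[inj₁]⇒inj₂ : ∀ {a} (v : Vertex s) → Adj (inj₁ a) v → v ≡ inj₂ (reduce v)
  Adj[inj₁]⇒inj₂ (inj₂ _) _ = refl

  ¬Adj[inj₂]⇒inj₂ : ∀ {a} (v : Vertex s) → ¬ Adj (inj₂ a) v → v ≡ inj₂ (reduce v)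
  ¬Adj[inj₂]⇒inj₂ (inj₁ _) ¬adj = ⊥-elim (¬adj tt)
  ¬Adj[inj₂]⇒inj₂ (inj₂ _) _ = refl

  Adj[inj₂]⇒inj₁ : ∀ {a} (v : Vertex s) → Adj (inj₂ a) v → v ≡ inj₁ (reduce v)
  Adj[inj₂]⇒inj₁ (inj₁ _) _ = refl

  edgeColor-inj₁-inj₂ : ∀ {c} (χ : EdgeColoring c s) {u v a b} (e : Adj u v) →
    u ≡ inj₁ a → v ≡ inj₂ b → edgeColor χ u v e ≡ χ a b
  edgeColor-inj₁-inj₂ χ _ refl refl = refl

  edgeColor-inj₂-inj₁ : ∀ {c} (χ : EdgeColoring c s) {u v a b} (e : Adj u v) →
    u ≡ inj₂ b → v ≡ inj₁ a → edgeColor χ u v e ≡ χ a b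
  edgeColor-inj₂-inj₁ χ _ refl refl = refl

module _ {s : ℕ} (A : Automorphism s) where
  open Automorphism A

  φ-injective : ∀ {u v} → φ u ≡ φ v → u ≡ v
  φ-injective {u} {v} eq = begin
    u                       ≡⟨ Inverse.strictlyInverseʳ perm u ⟨
    Inverse.from perm (φ u) ≡⟨ cong (Inverse.from perm) eq ⟩
    Inverse.from perm (φ v) ≡⟨ Inverse.strictlyInverseʳ perm v ⟩
    v                       ∎
    where open ≡-Reasoning

  φ-surjective : ∀ w → ∃ λ v → φ v ≡ w
  φ-surjective w = Inverse.from perm w , Inverse.strictlyInverseˡ perm w

  data SideAction : Set where
    keepsSides : (σ τ : Fin s → Fin s) →
      (∀ i → φ (inj₁ i) ≡ inj₁ (σ i)) → (∀ j → φ (inj₂ j) ≡ inj₂ (τ j)) → SideAction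
    swapsSides : (σ τ : Fin s → Fin s) →
      (∀ i → φ (inj₁ i) ≡ inj₂ (σ i)) → (∀ j → φ (inj₂ j) ≡ inj₁ (τ j)) → SideAction

sideAction : ∀ {s} (A : Automorphism s) → SideAction A
sideAction {zero} A = keepsSides (λ ()) (λ ()) (λ ()) (λ ())
sideAction {suc n} A = classify (φ (inj₁ zero)) refl
  where
  open Automorphism A

  classify : ∀ w → φ (inj₁ zero) ≡ w → SideAction A
  classify (inj₁ _) eq = keepsSides _ _
    (λ i → ¬Adj[inj₁]⇒inj₁ _ (reflects _ (inj₁ i) ∘ subst (λ w → Adj w (φ (inj₁ i))) (sym eq)))
    (λ j → Adj[inj₁]⇒inj₂ _ (subst (λ w → Adj w (φ (inj₂ j))) eq (preserves _ (inj₂ j) tt)))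
  classify (inj₂ _) eq = swapsSides _ _
    (λ i → ¬Adj[inj₂]⇒inj₂ _ (reflects _ (inj₁ i) ∘ subst (λ w → Adj w (φ (inj₁ i))) (sym eq)))
    (λ j → Adj[inj₂]⇒inj₁ _ (subst (λ w → Adj w (φ (inj₂ j))) eq (preserves _ (inj₂ j) tt)))

module KeepsSides {s} (A : Automorphism s) {σ τ : Fin s → Fin s}
  (hσ : ∀ i → Automorphism.φ A (inj₁ i) ≡ inj₁ (σ i))
  (hτ : ∀ j → Automorphism.φ A (inj₂ j) ≡ inj₂ (τ j)) where
  open Automorphism A

  σ-injective : ∀ {i i′} → σ i ≡ σ i′ → i ≡ i′
  σ-injective eq = inj₁-injective (φ-injective A (trans (hσ _) (trans (cong inj₁ eq) (sym (hσ _)))))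

  σ-surjective : ∀ r → ∃ λ i → σ i ≡ r
  σ-surjective r with φ-surjective A (inj₁ r)
  ... | inj₁ i , eq = i , inj₁-injective (trans (sym (hσ i)) eq)
  ... | inj₂ j , eq with () ← trans (sym (hτ j)) eq

  respects : ∀ {c} {χ : EdgeColoring c s} → ColorPreserving χ A → ∀ i j → χ i j ≡ χ (σ i) (τ j)
  respects {χ = χ} cp i j = trans (cp (inj₁ i) (inj₂ j) tt) (edgeColor-inj₁-inj₂ χ _ (hσ i) (hτ j))

  isIdentity : (∀ i → σ i ≡ i) → (∀ j → τ j ≡ j) → ∀ v → φ v ≡ v
  isIdentity σ≗id _ (inj₁ i) = trans (hσ i) (cong inj₁ (σ≗id i))
  isIdentity _ τ≗id (inj₂ j) = trans (hτ j) (cong inj₂ (τ≗id j))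

module SwapsSides {s} (A : Automorphism s) {σ τ : Fin s → Fin s}
  (hσ : ∀ i → Automorphism.φ A (inj₁ i) ≡ inj₂ (σ i))
  (hτ : ∀ j → Automorphism.φ A (inj₂ j) ≡ inj₁ (τ j)) where
  open Automorphism A

  σ-surjective : ∀ r → ∃ λ i → σ i ≡ r
  σ-surjective r with φ-surjective A (inj₂ r)
  ... | inj₁ i , eq = i , inj₂-injective (trans (sym (hσ i)) eq)
  ... | inj₂ j , eq with () ← trans (sym (hτ j)) eq

  respects : ∀ {c} {χ : EdgeColoring c s} → ColorPreserving χ A → ∀ i j → χ i j ≡ χ (τ j) (σ i)
  respects {χ = χ} cp i j = trans (cp (inj₁ i) (inj₂ j) tt) (edgeColor-inj₂-inj₁ χ _ (hσ i) (hτ j))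

module _ {c s : ℕ} (χ : EdgeColoring c s) {σ τ : Fin s → Fin s}
  (σ-surjective : ∀ r → ∃ λ i → σ i ≡ r) where

  monochromaticColumn⇒monochromaticRow : (∀ i j → χ i j ≡ χ (τ j) (σ i)) →
    ∀ {col x} → (∀ i → χ i col ≡ x) → ∀ j → χ (τ col) j ≡ x
  monochromaticColumn⇒monochromaticRow respects {col} {x} column j = begin
    χ (τ col) j     ≡⟨ cong (χ (τ col)) (sym σa≡j) ⟩
    χ (τ col) (σ a) ≡⟨ respects a col ⟨
    χ a col         ≡⟨ column a ⟩
    x               ∎
    where
    open ≡-Reasoning
    a = proj₁ (σ-surjective j)
    σa≡j = proj₂ (σ-surjective j)

  -- τ fixes j₀, since otherwise the two x's of column τ j₀ would both come from the single x
  -- of column j₀.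
  uniqueInColumn⇒rowFixed : (∀ i j → χ i j ≡ χ (σ i) (τ j)) → ∀ {x i₀ j₀} →
    (∀ i → χ i j₀ ≡ x → i ≡ i₀) → χ i₀ j₀ ≡ x →
    (∀ j → j ≢ j₀ → ∃₂ λ r r′ → r ≢ r′ × χ r j ≡ x × χ r′ j ≡ x) → σ i₀ ≡ i₀
  uniqueInColumn⇒rowFixed respects {x} {i₀} {j₀} unique entry twice =
    unique (σ i₀) (trans (cong (χ (σ i₀)) (sym τj₀≡j₀)) (trans (sym (respects i₀ j₀)) entry))
    where
    σi₀≡ : ∀ r → χ r (τ j₀) ≡ x → σ i₀ ≡ r
    σi₀≡ r χr with σ-surjective r
    ... | a , refl = cong σ (sym (unique a (trans (respects a j₀) χr)))

    τj₀≡j₀ : τ j₀ ≡ j₀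
    τj₀≡j₀ with τ j₀ ≟ j₀
    ... | yes eq = eq
    ... | no ne with twice (τ j₀) ne
    ...   | r , r′ , r≢r′ , χr , χr′ = ⊥-elim (r≢r′ (trans (sym (σi₀≡ r χr)) (σi₀≡ r′ χr′)))

indicator : ∀ {k} {P : Set} → Dec P → Fin (suc (suc k))
indicator (yes _) = suc zero
indicator (no _)  = zero

indicator≡1⇔ : ∀ {k} {P : Set} (d : Dec P) → indicator {k} d ≡ suc zero ⇔ P
indicator≡1⇔ (yes p) = mk⇔ (λ _ → p) (λ _ → refl)
indicator≡1⇔ (no ¬p) = mk⇔ (λ ()) (⊥-elim ∘ ¬p)

indicator≡0 : ∀ {k} {P : Set} (d : Dec P) → ¬ P → indicator {k} d ≡ zero
indicator≡0 (yes p) ¬p = contradiction p ¬p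
indicator≡0 (no _)  _  = refl

module Staircase {k n : ℕ} (mark : Fin (suc n) → Fin (suc (suc k))) where

  staircase : EdgeColoring (suc (suc k)) (suc n)
  staircase zero    j = mark j
  staircase (suc i) j = indicator (j <? suc i)

  staircase-column₀ : ∀ i → staircase (suc i) zero ≡ suc zero
  staircase-column₀ i = Equivalence.from (indicator≡1⇔ (zero {n} <? suc i)) (s≤s z≤n)

  staircase-above : ∀ i j → ¬ j < suc i → staircase (suc i) j ≡ zero
  staircase-above i j = indicator≡0 (j <? suc i)

  keepsSides-rigid : ∀ {σ τ : Fin (suc n) → Fin (suc n)} →
    (∀ {i i′} → σ i ≡ σ i′ → i ≡ i′) → σ zero ≡ zero →
    (∀ i j → staircase i j ≡ staircase (σ i) (τ j)) → (∀ i → σ i ≡ i) × (∀ j → τ j ≡ j)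
  keepsSides-rigid {σ} {τ} σ-injective σ₀ respects = staircase-rigid σ τ order
    where
    order : ∀ i j → j < i ⇔ τ j < σ i
    order zero j = mk⇔ (λ ()) (λ τj<σ₀ → contradiction (subst (τ j <_) σ₀ τj<σ₀) λ ())
    order (suc i) j = below (σ (suc i)) refl
      where
      below : ∀ r → σ (suc i) ≡ r → j < suc i ⇔ τ j < r
      below zero     eq = contradiction (σ-injective (trans eq (sym σ₀))) λ ()
      below (suc i′) eq =
        indicator≡1⇔ (τ j <? suc i′) ⇔-∘ (sameColor ⇔-∘ ⇔-sym (indicator≡1⇔ (j <? suc i)))
        where
        e = trans (respects (suc i) j) (cong (λ r → staircase r (τ j)) eq)
        sameColor : staircase (suc i) j ≡ suc zero ⇔ staircase (suc i′) (τ j) ≡ suc zero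
        sameColor = mk⇔ (trans (sym e)) (trans e)

  RowZeroFixed : Set
  RowZeroFixed = ∀ {σ τ : Fin (suc n) → Fin (suc n)} → (∀ r → ∃ λ i → σ i ≡ r) →
    (∀ i j → staircase i j ≡ staircase (σ i) (τ j)) → σ zero ≡ zero

  staircase-isIdentity : mark (fromℕ n) ≡ zero → (∃ λ j → mark j ≢ zero) → RowZeroFixed →
    IsIdentityColoring staircase
  staircase-isIdentity lastMark (j₁ , markj₁≢0) rowZeroFixed A cp with sideAction A
  ... | keepsSides σ τ hσ hτ = isIdentity (proj₁ rigid) (proj₂ rigid)
    where
    open KeepsSides A hσ hτ
    rigid = keepsSides-rigid σ-injective (rowZeroFixed σ-surjective (respects cp)) (respects cp)
  ... | swapsSides σ τ hσ hτ = ⊥-elim $ rowNotZero (τ (fromℕ n))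
      (monochromaticColumn⇒monochromaticRow staircase {τ = τ} σ-surjective (respects cp) lastColumn)
    where
    open SwapsSides A hσ hτ
    lastColumn : ∀ i → staircase i (fromℕ n) ≡ zero
    lastColumn zero    = lastMark
    lastColumn (suc i) = staircase-above i (fromℕ n) (ℕ.≤⇒≯ (≤fromℕ (suc i)))
    rowNotZero : ∀ i → ¬ (∀ j → staircase i j ≡ zero)
    rowNotZero zero    row = markj₁≢0 (row j₁)
    rowNotZero (suc i) row with () ← trans (sym (staircase-column₀ i)) (row zero)

module ThreeColors (k n : ℕ) where

  mark : Fin (suc (suc n)) → Fin (suc (suc (suc k)))
  mark zero    = suc (suc zero)
  mark (suc _) = zero

  open Staircase mark public

  rowZeroFixed : RowZeroFixed
  rowZeroFixed {σ} {τ} _ respects = onlyRowZeroIs2 (σ zero) (τ zero) (sym (respects zero zero))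
    where
    onlyRowZeroIs2 : ∀ i j → staircase i j ≡ suc (suc zero) → i ≡ zero
    onlyRowZeroIs2 zero    _ _ = refl
    onlyRowZeroIs2 (suc i) j eq with j <? suc i
    onlyRowZeroIs2 (suc i) j () | yes _
    onlyRowZeroIs2 (suc i) j () | no _

  isIdentity : IsIdentityColoring staircase
  isIdentity = staircase-isIdentity refl (zero , λ ()) rowZeroFixed

module TwoColors (k n : ℕ) where

  mark : Fin (suc (suc (suc (suc n)))) → Fin (suc (suc k))
  mark zero                = zero
  mark (suc zero)          = zero
  mark (suc (suc zero))    = suc zero
  mark (suc (suc (suc _))) = zero

  open Staircase mark public

  rowZeroFixed : RowZeroFixed
  rowZeroFixed σ-surjective respects =
    uniqueInColumn⇒rowFixed staircase σ-surjective respects onlyRowZero refl twoZeros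
    where
    onlyRowZero : ∀ i → staircase i zero ≡ zero → i ≡ zero
    onlyRowZero zero    _  = refl
    onlyRowZero (suc i) eq with () ← trans (sym (staircase-column₀ i)) eq
    twoZeros : ∀ j → j ≢ zero → ∃₂ λ r r′ → r ≢ r′ × staircase r j ≡ zero × staircase r′ j ≡ zero
    twoZeros zero                  j≢0 = ⊥-elim (j≢0 refl)
    twoZeros j@(suc zero)          _   = zero , suc zero , (λ ()) , refl ,
      staircase-above zero j λ { (s≤s ()) }
    twoZeros j@(suc (suc zero))    _   = suc zero , suc (suc zero) , (λ ()) ,
      staircase-above zero j (λ { (s≤s ()) }) , staircase-above (suc zero) j λ { (s≤s (s≤s ())) }
    twoZeros j@(suc (suc (suc _))) _   = zero , suc zero , (λ ()) , refl ,
      staircase-above zero j λ { (s≤s ()) }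

  isIdentity : IsIdentityColoring staircase
  isIdentity = staircase-isIdentity refl (suc (suc zero) , λ ()) rowZeroFixed

data Move (s : ℕ) : Set where
  keep swap : Permutation′ s → Permutation′ s → Move s

automorphism : ∀ {s} → Move s → Automorphism s
automorphism (keep π ρ) = record
  { perm      = π ⊎-↔ ρ
  ; preserves = λ { (inj₁ _) (inj₂ _) _ → tt ; (inj₂ _) (inj₁ _) _ → tt }
  ; reflects  = λ { (inj₁ _) (inj₂ _) _ → tt ; (inj₂ _) (inj₁ _) _ → tt }
  }
automorphism (swap π ρ) = record
  { perm      = ⊎-comm _ _ ↔-∘ (π ⊎-↔ ρ)
  ; preserves = λ { (inj₁ _) (inj₂ _) _ → tt ; (inj₂ _) (inj₁ _) _ → tt }
  ; reflects  = λ { (inj₁ _) (inj₂ _) _ → tt ; (inj₂ _) (inj₁ _) _ → tt }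
  }

module _ {c s : ℕ} where

  Respects : EdgeColoring c s → Move s → Set
  Respects χ (keep π ρ) = ∀ i j → χ i j ≡ χ (π ⟨$⟩ʳ i) (ρ ⟨$⟩ʳ j)
  Respects χ (swap π ρ) = ∀ i j → χ i j ≡ χ (ρ ⟨$⟩ʳ j) (π ⟨$⟩ʳ i)

  respects? : ∀ χ → Decidable (Respects χ)
  respects? χ (keep π ρ) = all? λ i → all? λ j → χ i j ≟ χ (π ⟨$⟩ʳ i) (ρ ⟨$⟩ʳ j)
  respects? χ (swap π ρ) = all? λ i → all? λ j → χ i j ≟ χ (ρ ⟨$⟩ʳ j) (π ⟨$⟩ʳ i)

  Respects⇒ColorPreserving : ∀ {χ} m → Respects χ m → ColorPreserving χ (automorphism m)
  Respects⇒ColorPreserving (keep _ _) r (inj₁ i) (inj₂ j) _ = r i j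
  Respects⇒ColorPreserving (keep _ _) r (inj₂ j) (inj₁ i) _ = r i j
  Respects⇒ColorPreserving (swap _ _) r (inj₁ i) (inj₂ j) _ = r i j
  Respects⇒ColorPreserving (swap _ _) r (inj₂ j) (inj₁ i) _ = r i j

  Respects-resp-≗ : ∀ {χ χ′} → (∀ i j → χ i j ≡ χ′ i j) → ∀ m → Respects χ′ m → Respects χ m
  Respects-resp-≗ χ≗χ′ (keep _ _) r i j = trans (χ≗χ′ i j) (trans (r i j) (sym (χ≗χ′ _ _)))
  Respects-resp-≗ χ≗χ′ (swap _ _) r i j = trans (χ≗χ′ i j) (trans (r i j) (sym (χ≗χ′ _ _)))

  Symmetry : EdgeColoring c s → Move s → Set
  Symmetry χ m = Respects χ m × ¬ (∀ v → Automorphism.φ (automorphism m) v ≡ v)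

  symmetry? : ∀ χ → Decidable (Symmetry χ)
  symmetry? χ m = respects? χ m ×-dec ¬? allFixed?
    where
    fixed? : ∀ v → Dec (Automorphism.φ (automorphism m) v ≡ v)
    fixed? v = ≡-dec _≟_ _≟_ _ v
    allFixed? : Dec (∀ v → Automorphism.φ (automorphism m) v ≡ v)
    allFixed? = map′ (uncurry [_,_]) (λ h → h ∘ inj₁ , h ∘ inj₂)
      (all? (fixed? ∘ inj₁) ×-dec all? (fixed? ∘ inj₂))

  symmetry⇒¬isIdentity : ∀ {χ m} → Symmetry χ m → ¬ IsIdentityColoring χ
  symmetry⇒¬isIdentity {m = m} (r , nontrivial) isId =
    nontrivial (isId (automorphism m) (Respects⇒ColorPreserving m r))

moves : ∀ {s} → List (Permutation′ s) → List (Move s)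
moves ps = concatMap (λ π → concatMap (λ ρ → keep π ρ ∷ swap π ρ ∷ []) ps) ps

Vec-all? : ∀ {A : Set} → (∀ {Q : A → Set} → Decidable Q → Dec (∀ a → Q a)) →
  ∀ {n} {Q : Vec A n → Set} → Decidable Q → Dec (∀ v → Q v)
Vec-all? A-all? {zero}  Q? = map′ (λ q → λ { [] → q }) (_$ []) (Q? [])
Vec-all? A-all? {suc n} Q? = map′ (λ q → λ { (a ∷ v) → q a v }) (λ q a v → q (a ∷ v))
  (A-all? λ a → Vec-all? A-all? λ v → Q? (a ∷ v))

table : ∀ {c s} → Vec (Vec (Fin c) s) s → EdgeColoring c s
table t i j = lookup (lookup t i) j

noIdentityColoring-bySearch : ∀ {c s} (ps : List (Permutation′ s)) →
  (∀ t → Any (Symmetry (table t)) (moves ps)) → (χ : EdgeColoring c s) → ¬ IsIdentityColoring χ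
noIdentityColoring-bySearch ps search χ =
  symmetry⇒¬isIdentity (Respects-resp-≗ χ≗t m r , nontrivial)
  where
  t = tabulate (tabulate ∘ χ)
  χ≗t : ∀ i j → χ i j ≡ table t i j
  χ≗t i j = sym (trans (cong (λ row → lookup row j) (lookup∘tabulate (tabulate ∘ χ) i))
                       (lookup∘tabulate (χ i) j))
  m = proj₁ (satisfied (search t))
  r = proj₁ (proj₂ (satisfied (search t)))
  nontrivial = proj₂ (proj₂ (satisfied (search t)))

S₂ : List (Permutation′ 2)
S₂ = id ∷ transpose zero (suc zero) ∷ []

S₃ : List (Permutation′ 3)
S₃ = id ∷ t₀₁ ∷ t₀₂ ∷ t₁₂ ∷ t₀₁ ∘ₚ t₁₂ ∷ t₁₂ ∘ₚ t₀₁ ∷ []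
  where
  t₀₁ t₀₂ t₁₂ : Permutation′ 3
  t₀₁ = transpose zero (suc zero)
  t₀₂ = transpose zero (suc (suc zero))
  t₁₂ = transpose (suc zero) (suc (suc zero))

noIdentityColoring₁ : ∀ {c} (χ : EdgeColoring c 1) → ¬ IsIdentityColoring χ
noIdentityColoring₁ χ = symmetry⇒¬isIdentity {m = swap id id}
  ((λ { zero zero → refl ; (suc ()) _ ; _ (suc ()) }) ,
   λ fixed → contradiction (fixed (inj₁ zero)) λ ())

noIdentityColoring₂₂ : (χ : EdgeColoring 2 2) → ¬ IsIdentityColoring χ
noIdentityColoring₂₂ = noIdentityColoring-bySearch S₂ $ toWitness
  {a? = Vec-all? (Vec-all? all?) λ t → any? (symmetry? (table t)) (moves S₂)} tt

noIdentityColoring₂₃ : (χ : EdgeColoring 2 3) → ¬ IsIdentityColoring χ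
noIdentityColoring₂₃ = noIdentityColoring-bySearch S₃ $ toWitness
  {a? = Vec-all? (Vec-all? all?) λ t → any? (symmetry? (table t)) (moves S₃)} tt

Exceptional : ℕ → ℕ → Set
Exceptional c s = s ≡ 1 ⊎ (c ≡ 2 × (s ≡ 2 ⊎ s ≡ 3))

exceptional⇒noIdentityColoring : ∀ {c s} → Exceptional c s → ¬ HasIdentityColoring c s
exceptional⇒noIdentityColoring (inj₁ refl)                (χ , isId) = noIdentityColoring₁ χ isId
exceptional⇒noIdentityColoring (inj₂ (refl , inj₁ refl)) (χ , isId) = noIdentityColoring₂₂ χ isId
exceptional⇒noIdentityColoring (inj₂ (refl , inj₂ refl)) (χ , isId) = noIdentityColoring₂₃ χ isId

identityColoring : ∀ c s → c ≥ 2 → ¬ Exceptional c s → HasIdentityColoring c s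
identityColoring _ zero _ _ = (λ ()) , λ _ _ → λ { (inj₁ ()) ; (inj₂ ()) }
identityColoring _ 1 _ exc = ⊥-elim (exc (inj₁ refl))
identityColoring (suc (suc k)) (suc (suc (suc (suc n)))) _ _ =
  TwoColors.staircase k n , TwoColors.isIdentity k n
identityColoring (suc (suc (suc k))) (suc (suc n)) _ _ =
  ThreeColors.staircase k n , ThreeColors.isIdentity k n
identityColoring 1 (suc (suc _)) (s≤s ()) _
identityColoring 2 2 _ exc = ⊥-elim (exc (inj₂ (refl , inj₁ refl)))
identityColoring 2 3 _ exc = ⊥-elim (exc (inj₂ (refl , inj₂ refl)))

lemma1 : (c s : ℕ) → c ≥ 2 →
    HasIdentityColoring c s ⇔ (¬ (s ≡ 1 ⊎ (c ≡ 2 × (s ≡ 2 ⊎ s ≡ 3))))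
lemma1 c s c≥2 = mk⇔ (λ has exc → exceptional⇒noIdentityColoring exc has) (identityColoring c s c≥2)
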